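{- There is an operator $\mathcal{E}_\omega$ on derivations in $\mathrm{BI}^\Omega$ such that for every derivation $d$ of $\mathrm{BI}^\Omega$: (1) for every sequent $\Gamma$, if $d\vdash_\omega\Gamma$ then $\mathcal{E}_\omega(d)\vdash_0\Gamma$; (2) $\Gamma(\mathcal{E}_\omega(d))=\Gamma(d)$.
   Context: Language $L$: terms are built from $0$ by successor $S$; atomic formulas are $R(t_1,\dots,t_n)$ ($R$ a symbol for an $n$-ary primitive recursive relation) and $X(t)$ ($X$ a unary set variable); literals are atomic formulas and their negations. Formulas are built from literals by $\wedge,\vee$, number quantifiers ($\forall xA(x),\exists xA(x)$ are formulas when $A(0)$ is; formulas have no free number variables) and $\forall XA,\exists XA$, allowed only when $A$ has no second-order quantifier and no free set variable other than $X$. Negation of non-atomic formulas is by De Morgan's laws. TRUE is the set of true closed literals $R(\vec n)$, $\neg R(\vec n)$. Rank: $rk(A)=0$ if $A$ is a literal or of the form $\forall XA(X)$ or $\exists XA(X)$; $rk(A\wedge B)=rk(A\vee B)=\max(rk(A),rk(B))+1$; $rk(\forall xA(x))=rk(\exists xA(x))=rk(A(0))+1$. A $\Pi^1$-formula has no subformula of the form $\exists XA(X)$; a $\Pi^1$-sequent is a finite set of $\Pi^1$-formulas. Sequents are finite sets; $\Gamma,A=\Gamma\cup\{A\}$. Derivations: each inference symbol $I$ has principal formulas $\Delta(I)$, index set $|I|$, minor formulas $\Delta_i(I)$ ($i\in|I|$). A derivation $d=I(d_i)_{i\in|I|}$ is a well-founded (possibly infinitely branching) labelled tree with end-sequent $\Gamma(d)$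 such that $\Delta(I)\subseteq\Gamma(d)$ and $\Gamma(d_i)\subseteq\Gamma(d)\cup\Delta_i(I)$ for all $i$; eigenvariables do not occur free in the conclusion of their inference. $\mathrm{BI}^\Omega_0$ has the rules: $\mathrm{Ax}_\Delta$ (no premises) with $\Delta=\{A\}\subseteq$ TRUE or $\Delta=\{C,\neg C\}$; $\bigwedge_{A_0\wedge A_1}$ (premises $A_0$, $A_1$); $\bigvee^k_{A_0\vee A_1}$, $k\in\{0,1\}$ (premise $A_k$); $\bigwedge_{\forall xA}$ (premises $A(\bar n)$ for all $n\in\omega$); $\bigvee^k_{\exists xA}$, $k\in\omega$ (premise $A(\bar k)$); $\bigwedge_{\forall XA}$ (premise $A(X/Y)$, $Y$ an eigenvariable); $\mathrm{Cut}_A$ ($\Delta=\emptyset$, premises with minor formulas $A$ and $\neg A$); $\mathrm{Rep}$ ($\Delta=\emptyset$, one premise with no minor formula). In each case the principal formula is the displayed conclusion formula. $\mathrm{BI}^\Omega$ adds two rules. Let $|\forall XA(X)|$ be the set of pairs $q=(e,Z)$ where $e$ is a derivation in $\mathrm{BI}^\Omega_0$ containing no Cut, $\Gamma(e)$ is a $\Pi^1$-sequent, $Z$ is a set variable, and $Z$ is not free in $\Delta_q:=\Gamma(e)\setminus\{A(Z)\}$. Rule $\Omega_{\neg\forall XA}$: $\Delta=\{\neg\forall XA\}$, index set $|\forall XA(X)|$, minor formulas $\Delta_q$ for premise $q$. Rule $\widetilde\Omega^Y_{\neg\forall XA}$: $\Delta=\emptyset$, index set $\{0\}\cup|\forall XA(X)|$,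 minor formulas $\{A(Y)\}$ for premise $0$ ($Y$ an eigenvariable) and $\Delta_q$ for premise $q$. Cut-degree: $dg(\mathrm{Cut}_C)=rk(C)+1$, $dg(I)=0$ for all other inference symbols (including $\widetilde\Omega$); $dg(I(d_i)_{i\in|I|})=\sup(\{dg(I)\}\cup\{dg(d_i):i\in|I|\})$ (a value $\le\omega$). We write $d\vdash_m\Gamma$ if $\Gamma(d)=\Gamma$ and $dg(d)\le m$ ($m\le\omega$). -}

module Defs where

open import Data.Nat using (ℕ; zero; suc; _≤_; _⊔_)
open import Data.Fin using (Fin; zero; suc)
open import Data.Vec using (Vec; []; _∷_; map; lookup)
open import Data.List using (List)
open import Data.List.Membership.Propositional using (_∈_)
open import Data.Bool using (Bool; true; false)
open import Data.Product using (Σ; _×_; _,_; proj₁; proj₂)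
open import Data.Sum using (_⊎_)
open import Data.Empty using (⊥)
open import Data.Unit using (⊤)
open import Relation.Nullary using (¬_)
open import Relation.Binary.PropositionalEquality using (_≡_)

-- Primitive recursive functions (codes and evaluation).
-- An n-ary primitive recursive relation symbol R is given by a code f of
-- its characteristic function; R(v) holds iff f(v) ≠ 0.

data PR : ℕ → Set where
  zer  : PR 0
  succ : PR 1
  proj : ∀ {n} → Fin n → PR n
  comp : ∀ {m n} → PR m → Vec (PR n) m → PR n
  prec : ∀ {n} → PR n → PR (suc (suc n)) → PR (suc n)

mutual
  eval : ∀ {n} → PR n → Vec ℕ n → ℕ
  eval zer [] = 0
  eval succ (x ∷ []) = suc x
  eval (proj i) v = lookup v i
  eval (comp f gs) v = eval f (evalV gs v)
  eval (prec g h) (x ∷ v) = evalRec g h x v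

  evalV : ∀ {m n} → Vec (PR n) m → Vec ℕ n → Vec ℕ m
  evalV [] v = []
  evalV (g ∷ gs) v = eval g v ∷ evalV gs v

  evalRec : ∀ {n} → PR n → PR (suc (suc n)) → ℕ → Vec ℕ n → ℕ
  evalRec g h zero v = eval g v
  evalRec g h (suc x) v = eval h (x ∷ evalRec g h x v ∷ v)

Holds : ∀ {k} → PR k → Vec ℕ k → Set
Holds f v = ¬ (eval f v ≡ 0)

-- Terms with n (de Bruijn) number variables; set variables are named by ℕ.

SV : Set
SV = ℕ

data Tm (n : ℕ) : Set where
  var : Fin n → Tm n
  O   : Tm n
  S   : Tm n → Tm n

num : ∀ {n} → ℕ → Tm n
num zero = O
num (suc k) = S (num k)

evalT : Tm 0 → ℕ
evalT (var ())
evalT O = 0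
evalT (S t) = suc (evalT t)

-- Bodies of second-order quantifiers: no second-order quantifier and no
-- free set variable other than the bound one (atoms bX t / bnX t = X(t), ¬X(t)).
data Bd (n : ℕ) : Set where
  brel bnrel : ∀ {k} → PR k → Vec (Tm n) k → Bd n
  bX bnX     : Tm n → Bd n
  band bor   : Bd n → Bd n → Bd n
  ball bex   : Bd (suc n) → Bd n

data Fm (n : ℕ) : Set where
  rel nrel : ∀ {k} → PR k → Vec (Tm n) k → Fm n
  mem nmem : SV → Tm n → Fm n
  _∧_ _∨_  : Fm n → Fm n → Fm n
  all ex   : Fm (suc n) → Fm n
  all2 ex2 : Bd n → Fm n

negB : ∀ {n} → Bd n → Bd n
negB (brel f ts) = bnrel f ts
negB (bnrel f ts) = brel f ts
negB (bX t) = bnX t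
negB (bnX t) = bX t
negB (band A B) = bor (negB A) (negB B)
negB (bor A B) = band (negB A) (negB B)
negB (ball A) = bex (negB A)
negB (bex A) = ball (negB A)

neg : ∀ {n} → Fm n → Fm n
neg (rel f ts) = nrel f ts
neg (nrel f ts) = rel f ts
neg (mem Y t) = nmem Y t
neg (nmem Y t) = mem Y t
neg (A ∧ B) = neg A ∨ neg B
neg (A ∨ B) = neg A ∧ neg B
neg (all A) = ex (neg A)
neg (ex A) = all (neg A)
neg (all2 A) = ex2 (negB A)
neg (ex2 A) = all2 (negB A)

renT : ∀ {m n} → (Fin m → Fin n) → Tm m → Tm n
renT ρ (var i) = var (ρ i)
renT ρ O = O
renT ρ (S t) = S (renT ρ t)

subT : ∀ {m n} → (Fin m → Tm n) → Tm m → Tm n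
subT σ (var i) = σ i
subT σ O = O
subT σ (S t) = S (subT σ t)

lift : ∀ {m n} → (Fin m → Tm n) → Fin (suc m) → Tm (suc n)
lift σ zero = var zero
lift σ (suc i) = renT suc (σ i)

subB : ∀ {m n} → (Fin m → Tm n) → Bd m → Bd n
subB σ (brel f ts) = brel f (map (subT σ) ts)
subB σ (bnrel f ts) = bnrel f (map (subT σ) ts)
subB σ (bX t) = bX (subT σ t)
subB σ (bnX t) = bnX (subT σ t)
subB σ (band A B) = band (subB σ A) (subB σ B)
subB σ (bor A B) = bor (subB σ A) (subB σ B)
subB σ (ball A) = ball (subB (lift σ) A)
subB σ (bex A) = bex (subB (lift σ) A)

subF : ∀ {m n} → (Fin m → Tm n) → Fm m → Fm n
subF σ (rel f ts) = rel f (map (subT σ) ts)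
subF σ (nrel f ts) = nrel f (map (subT σ) ts)
subF σ (mem Y t) = mem Y (subT σ t)
subF σ (nmem Y t) = nmem Y (subT σ t)
subF σ (A ∧ B) = subF σ A ∧ subF σ B
subF σ (A ∨ B) = subF σ A ∨ subF σ B
subF σ (all A) = all (subF (lift σ) A)
subF σ (ex A) = ex (subF (lift σ) A)
subF σ (all2 A) = all2 (subB σ A)
subF σ (ex2 A) = ex2 (subB σ A)

inst0 : ∀ {n} → ℕ → Fin (suc n) → Tm n
inst0 k zero = num k
inst0 k (suc i) = var i

inst : ∀ {n} → Fm (suc n) → ℕ → Fm n
inst A k = subF (inst0 k) A

instX : ∀ {n} → Bd n → SV → Fm n
instX (brel f ts) Y = rel f ts
instX (bnrel f ts) Y = nrel f ts
instX (bX t) Y = mem Y t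
instX (bnX t) Y = nmem Y t
instX (band A B) Y = instX A Y ∧ instX B Y
instX (bor A B) Y = instX A Y ∨ instX B Y
instX (ball A) Y = all (instX A Y)
instX (bex A) Y = ex (instX A Y)

-- rank (rk(∀x A(x)) = rk(A(0))+1 computed structurally; substitution
-- does not change rank)
rk : ∀ {n} → Fm n → ℕ
rk (rel f ts) = 0
rk (nrel f ts) = 0
rk (mem Y t) = 0
rk (nmem Y t) = 0
rk (A ∧ B) = suc (rk A ⊔ rk B)
rk (A ∨ B) = suc (rk A ⊔ rk B)
rk (all A) = suc (rk A)
rk (ex A) = suc (rk A)
rk (all2 A) = 0
rk (ex2 A) = 0

Π1 : ∀ {n} → Fm n → Set
Π1 (rel f ts) = ⊤
Π1 (nrel f ts) = ⊤
Π1 (mem Y t) = ⊤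
Π1 (nmem Y t) = ⊤
Π1 (A ∧ B) = Π1 A × Π1 B
Π1 (A ∨ B) = Π1 A × Π1 B
Π1 (all A) = Π1 A
Π1 (ex A) = Π1 A
Π1 (all2 A) = ⊤
Π1 (ex2 A) = ⊥

FreeIn : ∀ {n} → SV → Fm n → Set
FreeIn Y (rel f ts) = ⊥
FreeIn Y (nrel f ts) = ⊥
FreeIn Y (mem Z t) = Y ≡ Z
FreeIn Y (nmem Z t) = Y ≡ Z
FreeIn Y (A ∧ B) = FreeIn Y A ⊎ FreeIn Y B
FreeIn Y (A ∨ B) = FreeIn Y A ⊎ FreeIn Y B
FreeIn Y (all A) = FreeIn Y A
FreeIn Y (ex A) = FreeIn Y A
FreeIn Y (all2 A) = ⊥
FreeIn Y (ex2 A) = ⊥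

TRUE : Fm 0 → Set
TRUE (rel f ts) = Holds f (map evalT ts)
TRUE (nrel f ts) = ¬ Holds f (map evalT ts)
TRUE _ = ⊥

-- Sequents: finite sets of closed formulas, represented by lists
-- (only membership matters).

Seq : Set
Seq = List (Fm 0)

_⊆_ : Seq → Seq → Set
Δ ⊆ Γ = ∀ {B} → B ∈ Δ → B ∈ Γ

_≋_ : Seq → Seq → Set
Δ ≋ Γ = (Δ ⊆ Γ) × (Γ ⊆ Δ)

-- Γ(d_i) ⊆ Γ(d) ∪ Δ_i, where the minor-formula set Δ_i is given as a predicate
Sub : Seq → Seq → (Fm 0 → Set) → Set
Sub Δ Γ P = ∀ {B} → B ∈ Δ → (B ∈ Γ) ⊎ P B

NotFree : SV → Seq → Set
NotFree Y Γ = ∀ {B} → B ∈ Γ → ¬ FreeIn Y B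

Π1Seq : Seq → Set
Π1Seq Γ = ∀ {B} → B ∈ Γ → Π1 B

NoMinor : Fm 0 → Set
NoMinor _ = ⊥

sel : Bool → Fm 0 → Fm 0 → Fm 0
sel false A₀ A₁ = A₀
sel true  A₀ A₁ = A₁

data D0 : Seq → Set where
  ax   : ∀ {Γ} (A : Fm 0) → TRUE A → A ∈ Γ → D0 Γ
  axC  : ∀ {Γ} (C : Fm 0) → C ∈ Γ → neg C ∈ Γ → D0 Γ
  andI : ∀ {Γ Δ₀ Δ₁} (A₀ A₁ : Fm 0) → (A₀ ∧ A₁) ∈ Γ →
         D0 Δ₀ → Sub Δ₀ Γ (_≡ A₀) → D0 Δ₁ → Sub Δ₁ Γ (_≡ A₁) → D0 Γ
  orI  : ∀ {Γ Δ} (A₀ A₁ : Fm 0) (k : Bool) → (A₀ ∨ A₁) ∈ Γ →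
         D0 Δ → Sub Δ Γ (_≡ sel k A₀ A₁) → D0 Γ
  allI : ∀ {Γ} (A : Fm 1) → all A ∈ Γ → (Δ : ℕ → Seq) →
         ((n : ℕ) → D0 (Δ n)) → ((n : ℕ) → Sub (Δ n) Γ (_≡ inst A n)) → D0 Γ
  exI  : ∀ {Γ Δ} (A : Fm 1) (k : ℕ) → ex A ∈ Γ →
         D0 Δ → Sub Δ Γ (_≡ inst A k) → D0 Γ
  all2I : ∀ {Γ Δ} (A : Bd 0) (Y : SV) → all2 A ∈ Γ → NotFree Y Γ →
         D0 Δ → Sub Δ Γ (_≡ instX A Y) → D0 Γ
  cut  : ∀ {Γ Δ₀ Δ₁} (C : Fm 0) →
         D0 Δ₀ → Sub Δ₀ Γ (_≡ C) → D0 Δ₁ → Sub Δ₁ Γ (_≡ neg C) → D0 Γ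
  rep  : ∀ {Γ Δ} → D0 Δ → Sub Δ Γ NoMinor → D0 Γ

CutFree : ∀ {Γ} → D0 Γ → Set
CutFree (ax A x x₁) = ⊤
CutFree (axC C x x₁) = ⊤
CutFree (andI A₀ A₁ x d x₁ e x₂) = CutFree d × CutFree e
CutFree (orI A₀ A₁ k x d x₁) = CutFree d
CutFree (allI A x Δ ds x₁) = (n : ℕ) → CutFree (ds n)
CutFree (exI A k x d x₁) = CutFree d
CutFree (all2I A Y x x₁ d x₂) = CutFree d
CutFree (cut C d x e x₁) = ⊥
CutFree (rep d x) = CutFree d

record Idx (A : Bd 0) : Set where
  field
    Γe    : Seq
    e     : D0 Γe
    cf    : CutFree e
    pi    : Π1Seq Γe
    Z     : SV
    fresh : ∀ {B} → B ∈ Γe → ¬ (B ≡ instX A Z) → ¬ FreeIn Z B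

Minor : ∀ {A} → Idx A → Fm 0 → Set
Minor {A} q B = (B ∈ Idx.Γe q) × ¬ (B ≡ instX A (Idx.Z q))

data D : Seq → Set where
  ax   : ∀ {Γ} (A : Fm 0) → TRUE A → A ∈ Γ → D Γ
  axC  : ∀ {Γ} (C : Fm 0) → C ∈ Γ → neg C ∈ Γ → D Γ
  andI : ∀ {Γ Δ₀ Δ₁} (A₀ A₁ : Fm 0) → (A₀ ∧ A₁) ∈ Γ →
         D Δ₀ → Sub Δ₀ Γ (_≡ A₀) → D Δ₁ → Sub Δ₁ Γ (_≡ A₁) → D Γ
  orI  : ∀ {Γ Δ} (A₀ A₁ : Fm 0) (k : Bool) → (A₀ ∨ A₁) ∈ Γ →
         D Δ → Sub Δ Γ (_≡ sel k A₀ A₁) → D Γ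
  allI : ∀ {Γ} (A : Fm 1) → all A ∈ Γ → (Δ : ℕ → Seq) →
         ((n : ℕ) → D (Δ n)) → ((n : ℕ) → Sub (Δ n) Γ (_≡ inst A n)) → D Γ
  exI  : ∀ {Γ Δ} (A : Fm 1) (k : ℕ) → ex A ∈ Γ →
         D Δ → Sub Δ Γ (_≡ inst A k) → D Γ
  all2I : ∀ {Γ Δ} (A : Bd 0) (Y : SV) → all2 A ∈ Γ → NotFree Y Γ →
         D Δ → Sub Δ Γ (_≡ instX A Y) → D Γ
  cut  : ∀ {Γ Δ₀ Δ₁} (C : Fm 0) →
         D Δ₀ → Sub Δ₀ Γ (_≡ C) → D Δ₁ → Sub Δ₁ Γ (_≡ neg C) → D Γ
  rep  : ∀ {Γ Δ} → D Δ → Sub Δ Γ NoMinor → D Γ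
  Ω    : ∀ {Γ} (A : Bd 0) → neg (all2 A) ∈ Γ → (Δ : Idx A → Seq) →
         ((q : Idx A) → D (Δ q)) → ((q : Idx A) → Sub (Δ q) Γ (Minor q)) → D Γ
  Ω~   : ∀ {Γ Δ₀} (A : Bd 0) (Y : SV) → NotFree Y Γ →
         D Δ₀ → Sub Δ₀ Γ (_≡ instX A Y) →
         (Δ : Idx A → Seq) →
         ((q : Idx A) → D (Δ q)) → ((q : Idx A) → Sub (Δ q) Γ (Minor q)) → D Γ

data Bound : Set where
  fin : ℕ → Bound
  ω   : Bound

_≤B_ : Bound → Bound → Set
fin m ≤B fin n = m ≤ n
_     ≤B ω     = ⊤
ω     ≤B fin _ = ⊥

-- dg(d) ≤ m  (dg(d) is a sup, so this is: dg(I) ≤ m at every node)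
DgLe : ∀ {Γ} → Bound → D Γ → Set
DgLe m (ax A x x₁) = fin 0 ≤B m
DgLe m (axC C x x₁) = fin 0 ≤B m
DgLe m (andI A₀ A₁ x d x₁ e x₂) = (fin 0 ≤B m) × DgLe m d × DgLe m e
DgLe m (orI A₀ A₁ k x d x₁) = (fin 0 ≤B m) × DgLe m d
DgLe m (allI A x Δ ds x₁) = (fin 0 ≤B m) × ((n : ℕ) → DgLe m (ds n))
DgLe m (exI A k x d x₁) = (fin 0 ≤B m) × DgLe m d
DgLe m (all2I A Y x x₁ d x₂) = (fin 0 ≤B m) × DgLe m d
DgLe m (cut C d x e x₁) = (fin (suc (rk C)) ≤B m) × DgLe m d × DgLe m e
DgLe m (rep d x) = (fin 0 ≤B m) × DgLe m d
DgLe m (Ω A x Δ ds x₁) = (fin 0 ≤B m) × ((q : Idx A) → DgLe m (ds q))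
DgLe m (Ω~ A Y x d x₁ Δ ds x₂) =
  (fin 0 ≤B m) × DgLe m d × ((q : Idx A) → DgLe m (ds q))

Deriv : Set
Deriv = Σ Seq D

Γof : Deriv → Seq
Γof = proj₁

_⊢[_]_ : Deriv → Bound → Seq → Set
d ⊢[ m ] Γ = (Γof d ≋ Γ) × DgLe m (proj₂ d)

-- Cuts are eliminated by induction on the rank of the cut formula C.  One cut premise is
-- traversed following the occurrence of C, and every inference introducing C is replaced: an
-- axiom C, ¬C by the other premise, a logical inference by cuts of smaller rank against the
-- inverted other premise.  Cuts on ∀X A(X) need no induction: each ∀X-inference with premise
-- A(Y) becomes an Ω̃^Y-inference whose premise q is the derivation of ¬∀X A with every
-- Ω-inference for ¬∀X A cut down to its premise q.  Eigenvariables are kept fresh by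
-- renaming set variables along the traversal.

module Submission where

open import Defs
open import Data.Bool using (true; false)
open import Data.Empty using (⊥-elim)
open import Data.Fin as Fin using (Fin)
open import Data.List as List using (_∷_; _++_; filter)
open import Data.List.Membership.Propositional using (_∈_)
open import Data.List.Membership.Propositional.Properties
  using (∈-map⁺; ∈-map⁻; ∈-++⁺ˡ; ∈-++⁺ʳ; ∈-++⁻; ∈-filter⁺; ∈-filter⁻)
open import Data.List.Relation.Unary.Any using (here; there)
open import Data.Nat as ℕ using (ℕ; suc; _≤_; _<_; _⊔_; z≤n; s≤s)
open import Data.Nat.Properties using (≤-refl; ≤-trans; <-irrefl; m≤m⊔n; m≤n⊔m)
open import Data.Product using (Σ; ∃; _×_; _,_; uncurry; map₁; map₂)
import Data.Product.Properties as Σ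
open import Data.Sum using (_⊎_; inj₁; inj₂; [_,_]′)
import Data.Sum as Sum
open import Data.Unit using (tt)
open import Data.Vec using (Vec; []; _∷_)
import Data.Vec.Properties as Vec
open import Function using (_∘_; id)
open import Function.Bundles using (_↔_; Inverse; mk↔ₛ′)
open import Function.Construct.Composition using (_↔-∘_)
open import Function.Construct.Identity using (↔-id)
open import Function.Construct.Symmetry using (↔-sym)
open import Relation.Binary.Definitions using (DecidableEquality)
open import Relation.Binary.PropositionalEquality
  using (_≡_; _≢_; refl; sym; trans; cong; cong₂; subst)
open import Relation.Nullary using (¬_; yes; no; ¬?)
open import Relation.Nullary.Decidable using (map′; _×-dec_)

mutual
  _≟-PR_ : ∀ {n} → DecidableEquality (PR n)
  zer ≟-PR zer = yes refl
  succ ≟-PR succ = yes refl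
  proj i ≟-PR proj j = map′ (cong proj) (λ { refl → refl }) (i Fin.≟ j)
  comp {m} f fs ≟-PR comp {m′} g gs with m ℕ.≟ m′
  ... | no m≢m′ = no λ { refl → m≢m′ refl }
  ... | yes refl = map′ (uncurry (cong₂ comp)) (λ { refl → refl , refl }) (f ≟-PR g ×-dec fs ≟-PRs gs)
  prec f h ≟-PR prec g k = map′ (uncurry (cong₂ prec)) (λ { refl → refl , refl }) (f ≟-PR g ×-dec h ≟-PR k)
  zer ≟-PR comp _ _ = no λ ()
  succ ≟-PR proj _ = no λ ()
  succ ≟-PR comp _ _ = no λ ()
  succ ≟-PR prec _ _ = no λ ()
  proj _ ≟-PR succ = no λ ()
  proj _ ≟-PR comp _ _ = no λ ()
  proj _ ≟-PR prec _ _ = no λ ()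
  comp _ _ ≟-PR zer = no λ ()
  comp _ _ ≟-PR succ = no λ ()
  comp _ _ ≟-PR proj _ = no λ ()
  comp _ _ ≟-PR prec _ _ = no λ ()
  prec _ _ ≟-PR succ = no λ ()
  prec _ _ ≟-PR proj _ = no λ ()
  prec _ _ ≟-PR comp _ _ = no λ ()

  _≟-PRs_ : ∀ {m n} → DecidableEquality (Vec (PR n) m)
  [] ≟-PRs [] = yes refl
  (f ∷ fs) ≟-PRs (g ∷ gs) = map′ (uncurry (cong₂ _∷_)) (λ { refl → refl , refl }) (f ≟-PR g ×-dec fs ≟-PRs gs)

_≟-Tm_ : ∀ {n} → DecidableEquality (Tm n)
var i ≟-Tm var j = map′ (cong var) (λ { refl → refl }) (i Fin.≟ j)
O ≟-Tm O = yes refl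
S s ≟-Tm S t = map′ (cong S) (λ { refl → refl }) (s ≟-Tm t)
var _ ≟-Tm O = no λ ()
var _ ≟-Tm S _ = no λ ()
O ≟-Tm var _ = no λ ()
O ≟-Tm S _ = no λ ()
S _ ≟-Tm var _ = no λ ()
S _ ≟-Tm O = no λ ()

Atom : ℕ → Set
Atom n = Σ ℕ λ k → PR k × Vec (Tm n) k

_≟-Atom_ : ∀ {n} → DecidableEquality (Atom n)
_≟-Atom_ = Σ.≡-dec ℕ._≟_ (λ {k} → Σ.≡-dec _≟-PR_ (Vec.≡-dec _≟-Tm_))

_≟-Bd_ : ∀ {n} → DecidableEquality (Bd n)
brel f s ≟-Bd brel g t = map′ (λ { refl → refl }) (λ { refl → refl }) ((_ , f , s) ≟-Atom (_ , g , t))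
bnrel f s ≟-Bd bnrel g t = map′ (λ { refl → refl }) (λ { refl → refl }) ((_ , f , s) ≟-Atom (_ , g , t))
bX s ≟-Bd bX t = map′ (cong bX) (λ { refl → refl }) (s ≟-Tm t)
bnX s ≟-Bd bnX t = map′ (cong bnX) (λ { refl → refl }) (s ≟-Tm t)
band A B ≟-Bd band C D = map′ (uncurry (cong₂ band)) (λ { refl → refl , refl }) (A ≟-Bd C ×-dec B ≟-Bd D)
bor A B ≟-Bd bor C D = map′ (uncurry (cong₂ bor)) (λ { refl → refl , refl }) (A ≟-Bd C ×-dec B ≟-Bd D)
ball A ≟-Bd ball B = map′ (cong ball) (λ { refl → refl }) (A ≟-Bd B)
bex A ≟-Bd bex B = map′ (cong bex) (λ { refl → refl }) (A ≟-Bd B)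
brel _ _ ≟-Bd bnrel _ _ = no λ ()
brel _ _ ≟-Bd bX _ = no λ ()
brel _ _ ≟-Bd bnX _ = no λ ()
brel _ _ ≟-Bd band _ _ = no λ ()
brel _ _ ≟-Bd bor _ _ = no λ ()
brel _ _ ≟-Bd ball _ = no λ ()
brel _ _ ≟-Bd bex _ = no λ ()
bnrel _ _ ≟-Bd brel _ _ = no λ ()
bnrel _ _ ≟-Bd bX _ = no λ ()
bnrel _ _ ≟-Bd bnX _ = no λ ()
bnrel _ _ ≟-Bd band _ _ = no λ ()
bnrel _ _ ≟-Bd bor _ _ = no λ ()
bnrel _ _ ≟-Bd ball _ = no λ ()
bnrel _ _ ≟-Bd bex _ = no λ ()
bX _ ≟-Bd brel _ _ = no λ ()
bX _ ≟-Bd bnrel _ _ = no λ ()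
bX _ ≟-Bd bnX _ = no λ ()
bX _ ≟-Bd band _ _ = no λ ()
bX _ ≟-Bd bor _ _ = no λ ()
bX _ ≟-Bd ball _ = no λ ()
bX _ ≟-Bd bex _ = no λ ()
bnX _ ≟-Bd brel _ _ = no λ ()
bnX _ ≟-Bd bnrel _ _ = no λ ()
bnX _ ≟-Bd bX _ = no λ ()
bnX _ ≟-Bd band _ _ = no λ ()
bnX _ ≟-Bd bor _ _ = no λ ()
bnX _ ≟-Bd ball _ = no λ ()
bnX _ ≟-Bd bex _ = no λ ()
band _ _ ≟-Bd brel _ _ = no λ ()
band _ _ ≟-Bd bnrel _ _ = no λ ()
band _ _ ≟-Bd bX _ = no λ ()
band _ _ ≟-Bd bnX _ = no λ ()
band _ _ ≟-Bd bor _ _ = no λ ()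
band _ _ ≟-Bd ball _ = no λ ()
band _ _ ≟-Bd bex _ = no λ ()
bor _ _ ≟-Bd brel _ _ = no λ ()
bor _ _ ≟-Bd bnrel _ _ = no λ ()
bor _ _ ≟-Bd bX _ = no λ ()
bor _ _ ≟-Bd bnX _ = no λ ()
bor _ _ ≟-Bd band _ _ = no λ ()
bor _ _ ≟-Bd ball _ = no λ ()
bor _ _ ≟-Bd bex _ = no λ ()
ball _ ≟-Bd brel _ _ = no λ ()
ball _ ≟-Bd bnrel _ _ = no λ ()
ball _ ≟-Bd bX _ = no λ ()
ball _ ≟-Bd bnX _ = no λ ()
ball _ ≟-Bd band _ _ = no λ ()
ball _ ≟-Bd bor _ _ = no λ ()
ball _ ≟-Bd bex _ = no λ ()
bex _ ≟-Bd brel _ _ = no λ ()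
bex _ ≟-Bd bnrel _ _ = no λ ()
bex _ ≟-Bd bX _ = no λ ()
bex _ ≟-Bd bnX _ = no λ ()
bex _ ≟-Bd band _ _ = no λ ()
bex _ ≟-Bd bor _ _ = no λ ()
bex _ ≟-Bd ball _ = no λ ()

_≟-Fm_ : ∀ {n} → DecidableEquality (Fm n)
rel f s ≟-Fm rel g t = map′ (λ { refl → refl }) (λ { refl → refl }) ((_ , f , s) ≟-Atom (_ , g , t))
nrel f s ≟-Fm nrel g t = map′ (λ { refl → refl }) (λ { refl → refl }) ((_ , f , s) ≟-Atom (_ , g , t))
mem X s ≟-Fm mem Y t = map′ (uncurry (cong₂ mem)) (λ { refl → refl , refl }) (X ℕ.≟ Y ×-dec s ≟-Tm t)
nmem X s ≟-Fm nmem Y t = map′ (uncurry (cong₂ nmem)) (λ { refl → refl , refl }) (X ℕ.≟ Y ×-dec s ≟-Tm t)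
(A ∧ B) ≟-Fm (C ∧ D) = map′ (uncurry (cong₂ _∧_)) (λ { refl → refl , refl }) (A ≟-Fm C ×-dec B ≟-Fm D)
(A ∨ B) ≟-Fm (C ∨ D) = map′ (uncurry (cong₂ _∨_)) (λ { refl → refl , refl }) (A ≟-Fm C ×-dec B ≟-Fm D)
all A ≟-Fm all B = map′ (cong all) (λ { refl → refl }) (A ≟-Fm B)
ex A ≟-Fm ex B = map′ (cong ex) (λ { refl → refl }) (A ≟-Fm B)
all2 A ≟-Fm all2 B = map′ (cong all2) (λ { refl → refl }) (A ≟-Bd B)
ex2 A ≟-Fm ex2 B = map′ (cong ex2) (λ { refl → refl }) (A ≟-Bd B)
rel _ _ ≟-Fm nrel _ _ = no λ ()
rel _ _ ≟-Fm mem _ _ = no λ ()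
rel _ _ ≟-Fm nmem _ _ = no λ ()
rel _ _ ≟-Fm (_ ∧ _) = no λ ()
rel _ _ ≟-Fm (_ ∨ _) = no λ ()
rel _ _ ≟-Fm all _ = no λ ()
rel _ _ ≟-Fm ex _ = no λ ()
rel _ _ ≟-Fm all2 _ = no λ ()
rel _ _ ≟-Fm ex2 _ = no λ ()
nrel _ _ ≟-Fm rel _ _ = no λ ()
nrel _ _ ≟-Fm mem _ _ = no λ ()
nrel _ _ ≟-Fm nmem _ _ = no λ ()
nrel _ _ ≟-Fm (_ ∧ _) = no λ ()
nrel _ _ ≟-Fm (_ ∨ _) = no λ ()
nrel _ _ ≟-Fm all _ = no λ ()
nrel _ _ ≟-Fm ex _ = no λ ()
nrel _ _ ≟-Fm all2 _ = no λ ()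
nrel _ _ ≟-Fm ex2 _ = no λ ()
mem _ _ ≟-Fm rel _ _ = no λ ()
mem _ _ ≟-Fm nrel _ _ = no λ ()
mem _ _ ≟-Fm nmem _ _ = no λ ()
mem _ _ ≟-Fm (_ ∧ _) = no λ ()
mem _ _ ≟-Fm (_ ∨ _) = no λ ()
mem _ _ ≟-Fm all _ = no λ ()
mem _ _ ≟-Fm ex _ = no λ ()
mem _ _ ≟-Fm all2 _ = no λ ()
mem _ _ ≟-Fm ex2 _ = no λ ()
nmem _ _ ≟-Fm rel _ _ = no λ ()
nmem _ _ ≟-Fm nrel _ _ = no λ ()
nmem _ _ ≟-Fm mem _ _ = no λ ()
nmem _ _ ≟-Fm (_ ∧ _) = no λ ()
nmem _ _ ≟-Fm (_ ∨ _) = no λ ()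
nmem _ _ ≟-Fm all _ = no λ ()
nmem _ _ ≟-Fm ex _ = no λ ()
nmem _ _ ≟-Fm all2 _ = no λ ()
nmem _ _ ≟-Fm ex2 _ = no λ ()
(_ ∧ _) ≟-Fm rel _ _ = no λ ()
(_ ∧ _) ≟-Fm nrel _ _ = no λ ()
(_ ∧ _) ≟-Fm mem _ _ = no λ ()
(_ ∧ _) ≟-Fm nmem _ _ = no λ ()
(_ ∧ _) ≟-Fm (_ ∨ _) = no λ ()
(_ ∧ _) ≟-Fm all _ = no λ ()
(_ ∧ _) ≟-Fm ex _ = no λ ()
(_ ∧ _) ≟-Fm all2 _ = no λ ()
(_ ∧ _) ≟-Fm ex2 _ = no λ ()
(_ ∨ _) ≟-Fm rel _ _ = no λ ()
(_ ∨ _) ≟-Fm nrel _ _ = no λ ()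
(_ ∨ _) ≟-Fm mem _ _ = no λ ()
(_ ∨ _) ≟-Fm nmem _ _ = no λ ()
(_ ∨ _) ≟-Fm (_ ∧ _) = no λ ()
(_ ∨ _) ≟-Fm all _ = no λ ()
(_ ∨ _) ≟-Fm ex _ = no λ ()
(_ ∨ _) ≟-Fm all2 _ = no λ ()
(_ ∨ _) ≟-Fm ex2 _ = no λ ()
all _ ≟-Fm rel _ _ = no λ ()
all _ ≟-Fm nrel _ _ = no λ ()
all _ ≟-Fm mem _ _ = no λ ()
all _ ≟-Fm nmem _ _ = no λ ()
all _ ≟-Fm (_ ∧ _) = no λ ()
all _ ≟-Fm (_ ∨ _) = no λ ()
all _ ≟-Fm ex _ = no λ ()
all _ ≟-Fm all2 _ = no λ ()
all _ ≟-Fm ex2 _ = no λ ()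
ex _ ≟-Fm rel _ _ = no λ ()
ex _ ≟-Fm nrel _ _ = no λ ()
ex _ ≟-Fm mem _ _ = no λ ()
ex _ ≟-Fm nmem _ _ = no λ ()
ex _ ≟-Fm (_ ∧ _) = no λ ()
ex _ ≟-Fm (_ ∨ _) = no λ ()
ex _ ≟-Fm all _ = no λ ()
ex _ ≟-Fm all2 _ = no λ ()
ex _ ≟-Fm ex2 _ = no λ ()
all2 _ ≟-Fm rel _ _ = no λ ()
all2 _ ≟-Fm nrel _ _ = no λ ()
all2 _ ≟-Fm mem _ _ = no λ ()
all2 _ ≟-Fm nmem _ _ = no λ ()
all2 _ ≟-Fm (_ ∧ _) = no λ ()
all2 _ ≟-Fm (_ ∨ _) = no λ ()
all2 _ ≟-Fm all _ = no λ ()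
all2 _ ≟-Fm ex _ = no λ ()
all2 _ ≟-Fm ex2 _ = no λ ()
ex2 _ ≟-Fm rel _ _ = no λ ()
ex2 _ ≟-Fm nrel _ _ = no λ ()
ex2 _ ≟-Fm mem _ _ = no λ ()
ex2 _ ≟-Fm nmem _ _ = no λ ()
ex2 _ ≟-Fm (_ ∧ _) = no λ ()
ex2 _ ≟-Fm (_ ∨ _) = no λ ()
ex2 _ ≟-Fm all _ = no λ ()
ex2 _ ≟-Fm ex _ = no λ ()
ex2 _ ≟-Fm all2 _ = no λ ()

negB-involutive : ∀ {n} (A : Bd n) → negB (negB A) ≡ A
negB-involutive (brel f ts) = refl
negB-involutive (bnrel f ts) = refl
negB-involutive (bX t) = refl
negB-involutive (bnX t) = refl
negB-involutive (band A B) = cong₂ band (negB-involutive A) (negB-involutive B)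
negB-involutive (bor A B) = cong₂ bor (negB-involutive A) (negB-involutive B)
negB-involutive (ball A) = cong ball (negB-involutive A)
negB-involutive (bex A) = cong bex (negB-involutive A)

negB-injective : ∀ {n} {A B : Bd n} → negB A ≡ negB B → A ≡ B
negB-injective {A = A} {B} eq = trans (sym (negB-involutive A)) (trans (cong negB eq) (negB-involutive B))

neg-involutive : ∀ {n} (A : Fm n) → neg (neg A) ≡ A
neg-involutive (rel f ts) = refl
neg-involutive (nrel f ts) = refl
neg-involutive (mem Y t) = refl
neg-involutive (nmem Y t) = refl
neg-involutive (A ∧ B) = cong₂ _∧_ (neg-involutive A) (neg-involutive B)
neg-involutive (A ∨ B) = cong₂ _∨_ (neg-involutive A) (neg-involutive B)
neg-involutive (all A) = cong all (neg-involutive A)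
neg-involutive (ex A) = cong ex (neg-involutive A)
neg-involutive (all2 A) = cong all2 (negB-involutive A)
neg-involutive (ex2 A) = cong ex2 (negB-involutive A)

neg-≢ : ∀ {n} (A : Fm n) → neg A ≢ A
neg-≢ (rel f ts) ()
neg-≢ (nrel f ts) ()
neg-≢ (mem Y t) ()
neg-≢ (nmem Y t) ()
neg-≢ (A ∧ B) ()
neg-≢ (A ∨ B) ()
neg-≢ (all A) ()
neg-≢ (ex A) ()
neg-≢ (all2 A) ()
neg-≢ (ex2 A) ()

negB-subB : ∀ {m n} (σ : Fin m → Tm n) (A : Bd m) → negB (subB σ A) ≡ subB σ (negB A)
negB-subB σ (brel f ts) = refl
negB-subB σ (bnrel f ts) = refl
negB-subB σ (bX t) = refl
negB-subB σ (bnX t) = refl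
negB-subB σ (band A B) = cong₂ bor (negB-subB σ A) (negB-subB σ B)
negB-subB σ (bor A B) = cong₂ band (negB-subB σ A) (negB-subB σ B)
negB-subB σ (ball A) = cong bex (negB-subB (lift σ) A)
negB-subB σ (bex A) = cong ball (negB-subB (lift σ) A)

neg-subF : ∀ {m n} (σ : Fin m → Tm n) (A : Fm m) → neg (subF σ A) ≡ subF σ (neg A)
neg-subF σ (rel f ts) = refl
neg-subF σ (nrel f ts) = refl
neg-subF σ (mem Y t) = refl
neg-subF σ (nmem Y t) = refl
neg-subF σ (A ∧ B) = cong₂ _∨_ (neg-subF σ A) (neg-subF σ B)
neg-subF σ (A ∨ B) = cong₂ _∧_ (neg-subF σ A) (neg-subF σ B)
neg-subF σ (all A) = cong ex (neg-subF (lift σ) A)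
neg-subF σ (ex A) = cong all (neg-subF (lift σ) A)
neg-subF σ (all2 A) = cong ex2 (negB-subB σ A)
neg-subF σ (ex2 A) = cong all2 (negB-subB σ A)

neg-inst : ∀ {n} (A : Fm (suc n)) k → neg (inst A k) ≡ inst (neg A) k
neg-inst A k = neg-subF (inst0 k) A

neg-sel : ∀ k (A₀ A₁ : Fm 0) → neg (sel k A₀ A₁) ≡ sel k (neg A₀) (neg A₁)
neg-sel false A₀ A₁ = refl
neg-sel true A₀ A₁ = refl

rk-subF : ∀ {m n} (σ : Fin m → Tm n) (A : Fm m) → rk (subF σ A) ≡ rk A
rk-subF σ (rel f ts) = refl
rk-subF σ (nrel f ts) = refl
rk-subF σ (mem Y t) = refl
rk-subF σ (nmem Y t) = refl
rk-subF σ (A ∧ B) = cong₂ (λ a b → suc (a ⊔ b)) (rk-subF σ A) (rk-subF σ B)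
rk-subF σ (A ∨ B) = cong₂ (λ a b → suc (a ⊔ b)) (rk-subF σ A) (rk-subF σ B)
rk-subF σ (all A) = cong suc (rk-subF (lift σ) A)
rk-subF σ (ex A) = cong suc (rk-subF (lift σ) A)
rk-subF σ (all2 A) = refl
rk-subF σ (ex2 A) = refl

rk-neg : ∀ {n} (A : Fm n) → rk (neg A) ≡ rk A
rk-neg (rel f ts) = refl
rk-neg (nrel f ts) = refl
rk-neg (mem Y t) = refl
rk-neg (nmem Y t) = refl
rk-neg (A ∧ B) = cong₂ (λ a b → suc (a ⊔ b)) (rk-neg A) (rk-neg B)
rk-neg (A ∨ B) = cong₂ (λ a b → suc (a ⊔ b)) (rk-neg A) (rk-neg B)
rk-neg (all A) = cong suc (rk-neg A)
rk-neg (ex A) = cong suc (rk-neg A)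
rk-neg (all2 A) = refl
rk-neg (ex2 A) = refl

TRUE-neg : (A : Fm 0) → TRUE A → ¬ TRUE (neg A)
TRUE-neg (rel f ts) holds fails = fails holds
TRUE-neg (nrel f ts) fails holds = fails holds

renF : ∀ {n} → (SV → SV) → Fm n → Fm n
renF r (rel f ts) = rel f ts
renF r (nrel f ts) = nrel f ts
renF r (mem Y t) = mem (r Y) t
renF r (nmem Y t) = nmem (r Y) t
renF r (A ∧ B) = renF r A ∧ renF r B
renF r (A ∨ B) = renF r A ∨ renF r B
renF r (all A) = all (renF r A)
renF r (ex A) = ex (renF r A)
renF r (all2 A) = all2 A
renF r (ex2 A) = ex2 A

renF-subF : ∀ {m n} r (σ : Fin m → Tm n) (A : Fm m) → renF r (subF σ A) ≡ subF σ (renF r A)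
renF-subF r σ (rel f ts) = refl
renF-subF r σ (nrel f ts) = refl
renF-subF r σ (mem Y t) = refl
renF-subF r σ (nmem Y t) = refl
renF-subF r σ (A ∧ B) = cong₂ _∧_ (renF-subF r σ A) (renF-subF r σ B)
renF-subF r σ (A ∨ B) = cong₂ _∨_ (renF-subF r σ A) (renF-subF r σ B)
renF-subF r σ (all A) = cong all (renF-subF r (lift σ) A)
renF-subF r σ (ex A) = cong ex (renF-subF r (lift σ) A)
renF-subF r σ (all2 A) = refl
renF-subF r σ (ex2 A) = refl

renF-inst : ∀ {n} r (A : Fm (suc n)) k → renF r (inst A k) ≡ inst (renF r A) k
renF-inst r A k = renF-subF r (inst0 k) A

renF-neg : ∀ {n} r (A : Fm n) → renF r (neg A) ≡ neg (renF r A)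
renF-neg r (rel f ts) = refl
renF-neg r (nrel f ts) = refl
renF-neg r (mem Y t) = refl
renF-neg r (nmem Y t) = refl
renF-neg r (A ∧ B) = cong₂ _∨_ (renF-neg r A) (renF-neg r B)
renF-neg r (A ∨ B) = cong₂ _∧_ (renF-neg r A) (renF-neg r B)
renF-neg r (all A) = cong ex (renF-neg r A)
renF-neg r (ex A) = cong all (renF-neg r A)
renF-neg r (all2 A) = refl
renF-neg r (ex2 A) = refl

renF-sel : ∀ r k (A₀ A₁ : Fm 0) → renF r (sel k A₀ A₁) ≡ sel k (renF r A₀) (renF r A₁)
renF-sel r false A₀ A₁ = refl
renF-sel r true A₀ A₁ = refl

renF-instX : ∀ {n} r (A : Bd n) Y → renF r (instX A Y) ≡ instX A (r Y)
renF-instX r (brel f ts) Y = refl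
renF-instX r (bnrel f ts) Y = refl
renF-instX r (bX t) Y = refl
renF-instX r (bnX t) Y = refl
renF-instX r (band A B) Y = cong₂ _∧_ (renF-instX r A Y) (renF-instX r B Y)
renF-instX r (bor A B) Y = cong₂ _∨_ (renF-instX r A Y) (renF-instX r B Y)
renF-instX r (ball A) Y = cong all (renF-instX r A Y)
renF-instX r (bex A) Y = cong ex (renF-instX r A Y)

renF-cong : ∀ {n} r s (A : Fm n) → (∀ Z → FreeIn Z A → r Z ≡ s Z) → renF r A ≡ renF s A
renF-cong r s (rel f ts) eq = refl
renF-cong r s (nrel f ts) eq = refl
renF-cong r s (mem Y t) eq = cong (λ Z → mem Z t) (eq Y refl)
renF-cong r s (nmem Y t) eq = cong (λ Z → nmem Z t) (eq Y refl)
renF-cong r s (A ∧ B) eq =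
  cong₂ _∧_ (renF-cong r s A (λ Z → eq Z ∘ inj₁)) (renF-cong r s B (λ Z → eq Z ∘ inj₂))
renF-cong r s (A ∨ B) eq =
  cong₂ _∨_ (renF-cong r s A (λ Z → eq Z ∘ inj₁)) (renF-cong r s B (λ Z → eq Z ∘ inj₂))
renF-cong r s (all A) eq = cong all (renF-cong r s A eq)
renF-cong r s (ex A) eq = cong ex (renF-cong r s A eq)
renF-cong r s (all2 A) eq = refl
renF-cong r s (ex2 A) eq = refl

renF-id : ∀ {n} (A : Fm n) → renF id A ≡ A
renF-id (rel f ts) = refl
renF-id (nrel f ts) = refl
renF-id (mem Y t) = refl
renF-id (nmem Y t) = refl
renF-id (A ∧ B) = cong₂ _∧_ (renF-id A) (renF-id B)
renF-id (A ∨ B) = cong₂ _∨_ (renF-id A) (renF-id B)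
renF-id (all A) = cong all (renF-id A)
renF-id (ex A) = cong ex (renF-id A)
renF-id (all2 A) = refl
renF-id (ex2 A) = refl

renF-inverse : ∀ {n} r s (A : Fm n) → (∀ Z → r (s Z) ≡ Z) → renF r (renF s A) ≡ A
renF-inverse r s (rel f ts) rs = refl
renF-inverse r s (nrel f ts) rs = refl
renF-inverse r s (mem Y t) rs = cong (λ Z → mem Z t) (rs Y)
renF-inverse r s (nmem Y t) rs = cong (λ Z → nmem Z t) (rs Y)
renF-inverse r s (A ∧ B) rs = cong₂ _∧_ (renF-inverse r s A rs) (renF-inverse r s B rs)
renF-inverse r s (A ∨ B) rs = cong₂ _∨_ (renF-inverse r s A rs) (renF-inverse r s B rs)
renF-inverse r s (all A) rs = cong all (renF-inverse r s A rs)
renF-inverse r s (ex A) rs = cong ex (renF-inverse r s A rs)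
renF-inverse r s (all2 A) rs = refl
renF-inverse r s (ex2 A) rs = refl

FreeIn-renF⁺ : ∀ {n} r (A : Fm n) {Z} → FreeIn Z A → FreeIn (r Z) (renF r A)
FreeIn-renF⁺ r (mem Y t) refl = refl
FreeIn-renF⁺ r (nmem Y t) refl = refl
FreeIn-renF⁺ r (A ∧ B) = Sum.map (FreeIn-renF⁺ r A) (FreeIn-renF⁺ r B)
FreeIn-renF⁺ r (A ∨ B) = Sum.map (FreeIn-renF⁺ r A) (FreeIn-renF⁺ r B)
FreeIn-renF⁺ r (all A) = FreeIn-renF⁺ r A
FreeIn-renF⁺ r (ex A) = FreeIn-renF⁺ r A

FreeIn-renF⁻ : ∀ {n} r (A : Fm n) {Z} → FreeIn Z (renF r A) → ∃ λ Z′ → FreeIn Z′ A × r Z′ ≡ Z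
FreeIn-renF⁻ r (mem Y t) refl = Y , refl , refl
FreeIn-renF⁻ r (nmem Y t) refl = Y , refl , refl
FreeIn-renF⁻ r (A ∧ B) (inj₁ free) = map₂ (map₁ inj₁) (FreeIn-renF⁻ r A free)
FreeIn-renF⁻ r (A ∧ B) (inj₂ free) = map₂ (map₁ inj₂) (FreeIn-renF⁻ r B free)
FreeIn-renF⁻ r (A ∨ B) (inj₁ free) = map₂ (map₁ inj₁) (FreeIn-renF⁻ r A free)
FreeIn-renF⁻ r (A ∨ B) (inj₂ free) = map₂ (map₁ inj₂) (FreeIn-renF⁻ r B free)
FreeIn-renF⁻ r (all A) = FreeIn-renF⁻ r A
FreeIn-renF⁻ r (ex A) = FreeIn-renF⁻ r A

TRUE-renF : ∀ r (A : Fm 0) → TRUE A → TRUE (renF r A)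
TRUE-renF r (rel f ts) holds = holds
TRUE-renF r (nrel f ts) fails = fails

Π1-renF : ∀ {n} r (A : Fm n) → Π1 A → Π1 (renF r A)
Π1-renF r (rel f ts) _ = tt
Π1-renF r (nrel f ts) _ = tt
Π1-renF r (mem Y t) _ = tt
Π1-renF r (nmem Y t) _ = tt
Π1-renF r (A ∧ B) (πA , πB) = Π1-renF r A πA , Π1-renF r B πB
Π1-renF r (A ∨ B) (πA , πB) = Π1-renF r A πA , Π1-renF r B πB
Π1-renF r (all A) πA = Π1-renF r A πA
Π1-renF r (ex A) πA = Π1-renF r A πA
Π1-renF r (all2 A) _ = tt


Perm : Set
Perm = SV ↔ SV

open Inverse using (to; from; strictlyInverseˡ; strictlyInverseʳ)

ren : ∀ {n} → Perm → Fm n → Fm n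
ren ρ = renF (to ρ)

to-injective : ∀ (ρ : Perm) {X Y} → to ρ X ≡ to ρ Y → X ≡ Y
to-injective ρ {X} {Y} eq =
  trans (sym (strictlyInverseʳ ρ X)) (trans (cong (from ρ) eq) (strictlyInverseʳ ρ Y))

FreeIn-ren⁻ : ∀ {n} ρ (A : Fm n) {Z} → FreeIn (to ρ Z) (ren ρ A) → FreeIn Z A
FreeIn-ren⁻ ρ A free with FreeIn-renF⁻ (to ρ) A free
... | Z′ , free′ , eq = subst (λ Z → FreeIn Z A) (to-injective ρ eq) free′

ren-from : ∀ {n} ρ (A : Fm n) → ren ρ (ren (↔-sym ρ) A) ≡ A
ren-from ρ A = renF-inverse (to ρ) (from ρ) A (strictlyInverseˡ ρ)

swap : SV → SV → SV → SV
swap a b x with x ℕ.≟ a | x ℕ.≟ b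
... | yes _ | _ = b
... | no _ | yes _ = a
... | no _ | no _ = x

swap-≡ˡ : ∀ a b → swap a b a ≡ b
swap-≡ˡ a b with a ℕ.≟ a
... | yes _ = refl
... | no a≢a = ⊥-elim (a≢a refl)

swap-≡ʳ : ∀ a b → swap a b b ≡ a
swap-≡ʳ a b with b ℕ.≟ a | b ℕ.≟ b
... | yes b≡a | _ = b≡a
... | no _ | yes _ = refl
... | no _ | no b≢b = ⊥-elim (b≢b refl)

swap-≢ : ∀ a b x → x ≢ a → x ≢ b → swap a b x ≡ x
swap-≢ a b x x≢a x≢b with x ℕ.≟ a | x ℕ.≟ b
... | yes x≡a | _ = ⊥-elim (x≢a x≡a)
... | no _ | yes x≡b = ⊥-elim (x≢b x≡b)
... | no _ | no _ = refl

swap-involutive : ∀ a b x → swap a b (swap a b x) ≡ x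
swap-involutive a b x with x ℕ.≟ a | x ℕ.≟ b
... | yes refl | _ = swap-≡ʳ a b
... | no _ | yes refl = swap-≡ˡ a b
... | no x≢a | no x≢b = swap-≢ a b x x≢a x≢b

transposition : SV → SV → Perm
transposition a b = mk↔ₛ′ (swap a b) (swap a b) (swap-involutive a b) (swap-involutive a b)


bound : ∀ {n} → Fm n → SV
bound (rel f ts) = 0
bound (nrel f ts) = 0
bound (mem Y t) = suc Y
bound (nmem Y t) = suc Y
bound (A ∧ B) = bound A ⊔ bound B
bound (A ∨ B) = bound A ⊔ bound B
bound (all A) = bound A
bound (ex A) = bound A
bound (all2 A) = 0
bound (ex2 A) = 0

FreeIn⇒<bound : ∀ {n} (A : Fm n) {Y} → FreeIn Y A → Y < bound A
FreeIn⇒<bound (mem Z t) refl = ≤-refl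
FreeIn⇒<bound (nmem Z t) refl = ≤-refl
FreeIn⇒<bound (A ∧ B) (inj₁ free) = ≤-trans (FreeIn⇒<bound A free) (m≤m⊔n _ _)
FreeIn⇒<bound (A ∧ B) (inj₂ free) = ≤-trans (FreeIn⇒<bound B free) (m≤n⊔m _ _)
FreeIn⇒<bound (A ∨ B) (inj₁ free) = ≤-trans (FreeIn⇒<bound A free) (m≤m⊔n _ _)
FreeIn⇒<bound (A ∨ B) (inj₂ free) = ≤-trans (FreeIn⇒<bound B free) (m≤n⊔m _ _)
FreeIn⇒<bound (all A) free = FreeIn⇒<bound A free
FreeIn⇒<bound (ex A) free = FreeIn⇒<bound A free

freshFor : Seq → SV
freshFor = List.foldr (λ A Y → bound A ⊔ Y) 0

bound≤freshFor : ∀ {Γ A} → A ∈ Γ → bound A ≤ freshFor Γ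
bound≤freshFor (here refl) = m≤m⊔n _ _
bound≤freshFor {B ∷ Γ} (there A∈Γ) = ≤-trans (bound≤freshFor A∈Γ) (m≤n⊔m (bound B) (freshFor Γ))

freshFor-NotFree : ∀ Γ → NotFree (freshFor Γ) Γ
freshFor-NotFree Γ {A} A∈Γ free = <-irrefl refl (≤-trans (FreeIn⇒<bound A free) (bound≤freshFor A∈Γ))


_∖_ : Seq → Fm 0 → Seq
Δ ∖ C = filter (λ B → ¬? (B ≟-Fm C)) Δ

∈-∖⁺ : ∀ {Δ C B} → B ∈ Δ → B ≢ C → B ∈ Δ ∖ C
∈-∖⁺ {C = C} = ∈-filter⁺ (λ B → ¬? (B ≟-Fm C))

∈-∖⁻ : ∀ {Δ C B} → B ∈ Δ ∖ C → B ∈ Δ × B ≢ C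
∈-∖⁻ {C = C} = ∈-filter⁻ (λ B → ¬? (B ≟-Fm C))

Sub-map : ∀ {Δ Γ} {P Q : Fm 0 → Set} → (∀ {B} → P B → B ∈ Γ ⊎ Q B) → Sub Δ Γ P → Sub Δ Γ Q
Sub-map f sub B∈Δ = [ inj₁ , f ]′ (sub B∈Δ)

Sub-∷ : ∀ {A Γ} → Sub (A ∷ Γ) Γ (_≡ A)
Sub-∷ (here refl) = inj₂ refl
Sub-∷ (there B∈Γ) = inj₁ B∈Γ

Sub-weaken : ∀ {Δ Γ Θ} {P : Fm 0 → Set} → Γ ⊆ Θ → Sub Δ Γ P → Sub Δ Θ P
Sub-weaken Γ⊆Θ sub = Sum.map₁ Γ⊆Θ ∘ sub

Sub⇒⊆ : ∀ {Δ Γ C} → C ∈ Γ → Sub Δ Γ (_≡ C) → Δ ⊆ Γ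
Sub⇒⊆ C∈Γ sub B∈Δ = [ id , (λ { refl → C∈Γ }) ]′ (sub B∈Δ)

mutual
  data CF (Γ : Seq) : Set where
    infer : ∀ {A} → A ∈ Γ → Principal Γ A → CF Γ
    Ω~    : ∀ {Δ₀} (A : Bd 0) (Y : SV) → NotFree Y Γ → CF Δ₀ → Sub Δ₀ Γ (_≡ instX A Y) →
            (Δ : Idx A → Seq) → (∀ q → CF (Δ q)) → (∀ q → Sub (Δ q) Γ (Minor q)) → CF Γ
    rep   : ∀ {Δ} → CF Δ → Sub Δ Γ NoMinor → CF Γ

  -- Principal Γ A is an inference with principal formula A and conclusion Γ ∪ {A}, so that
  -- it also describes an inference whose principal formula was removed from the conclusion.
  data Principal (Γ : Seq) : Fm 0 → Set where
    ax    : ∀ {A} → TRUE A → Principal Γ A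
    axC   : ∀ {C} → neg C ∈ Γ → Principal Γ C
    andI  : ∀ {A₀ A₁ Δ₀ Δ₁} → CF Δ₀ → Sub Δ₀ Γ (_≡ A₀) → CF Δ₁ → Sub Δ₁ Γ (_≡ A₁) →
            Principal Γ (A₀ ∧ A₁)
    orI   : ∀ {A₀ A₁ Δ} k → CF Δ → Sub Δ Γ (_≡ sel k A₀ A₁) → Principal Γ (A₀ ∨ A₁)
    allI  : ∀ {A} (Δ : ℕ → Seq) → (∀ n → CF (Δ n)) → (∀ n → Sub (Δ n) Γ (_≡ inst A n)) →
            Principal Γ (all A)
    exI   : ∀ {A Δ} k → CF Δ → Sub Δ Γ (_≡ inst A k) → Principal Γ (ex A)
    all2I : ∀ {A Δ} Y → NotFree Y Γ → CF Δ → Sub Δ Γ (_≡ instX A Y) → Principal Γ (all2 A)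
    Ω     : ∀ {A B} → B ≡ negB A → (Δ : Idx A → Seq) → (∀ q → CF (Δ q)) →
            (∀ q → Sub (Δ q) Γ (Minor q)) → Principal Γ (ex2 B)

weaken : ∀ {Δ Γ} → CF Δ → Δ ⊆ Γ → CF Γ
weaken d Δ⊆Γ = rep d (inj₁ ∘ Δ⊆Γ)

mutual
  embed : ∀ {Γ} → CF Γ → D Γ
  embed (infer A∈Γ r) = embedPrincipal A∈Γ r
  embed (Ω~ A Y Y∉Γ d sub Δ ds subs) = Ω~ A Y Y∉Γ (embed d) sub Δ (embed ∘ ds) subs
  embed (rep d sub) = rep (embed d) sub

  embedPrincipal : ∀ {Γ A} → A ∈ Γ → Principal Γ A → D Γ
  embedPrincipal A∈Γ (ax isTrue) = ax _ isTrue A∈Γ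
  embedPrincipal A∈Γ (axC ¬A∈Γ) = axC _ A∈Γ ¬A∈Γ
  embedPrincipal A∈Γ (andI d₀ sub₀ d₁ sub₁) = andI _ _ A∈Γ (embed d₀) sub₀ (embed d₁) sub₁
  embedPrincipal A∈Γ (orI k d sub) = orI _ _ k A∈Γ (embed d) sub
  embedPrincipal A∈Γ (allI Δ ds subs) = allI _ A∈Γ Δ (embed ∘ ds) subs
  embedPrincipal A∈Γ (exI k d sub) = exI _ k A∈Γ (embed d) sub
  embedPrincipal A∈Γ (all2I Y Y∉Γ d sub) = all2I _ Y A∈Γ Y∉Γ (embed d) sub
  embedPrincipal A∈Γ (Ω refl Δ ds subs) = Ω _ A∈Γ Δ (embed ∘ ds) subs

mutual
  embed-cutFree : ∀ {Γ} (d : CF Γ) → DgLe (fin 0) (embed d)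
  embed-cutFree (infer A∈Γ r) = embedPrincipal-cutFree A∈Γ r
  embed-cutFree (Ω~ A Y Y∉Γ d sub Δ ds subs) = z≤n , embed-cutFree d , embed-cutFree ∘ ds
  embed-cutFree (rep d sub) = z≤n , embed-cutFree d

  embedPrincipal-cutFree : ∀ {Γ A} (A∈Γ : A ∈ Γ) (r : Principal Γ A) →
                           DgLe (fin 0) (embedPrincipal A∈Γ r)
  embedPrincipal-cutFree A∈Γ (ax isTrue) = z≤n
  embedPrincipal-cutFree A∈Γ (axC ¬A∈Γ) = z≤n
  embedPrincipal-cutFree A∈Γ (andI d₀ sub₀ d₁ sub₁) = z≤n , embed-cutFree d₀ , embed-cutFree d₁
  embedPrincipal-cutFree A∈Γ (orI k d sub) = z≤n , embed-cutFree d
  embedPrincipal-cutFree A∈Γ (allI Δ ds subs) = z≤n , embed-cutFree ∘ ds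
  embedPrincipal-cutFree A∈Γ (exI k d sub) = z≤n , embed-cutFree d
  embedPrincipal-cutFree A∈Γ (all2I Y Y∉Γ d sub) = z≤n , embed-cutFree d
  embedPrincipal-cutFree A∈Γ (Ω refl Δ ds subs) = z≤n , embed-cutFree ∘ ds

fromD0 : ∀ {Γ} (e : D0 Γ) → CutFree e → CF Γ
fromD0 (ax A isTrue A∈Γ) _ = infer A∈Γ (ax isTrue)
fromD0 (axC C C∈Γ ¬C∈Γ) _ = infer C∈Γ (axC ¬C∈Γ)
fromD0 (andI A₀ A₁ A∈Γ d₀ sub₀ d₁ sub₁) (cf₀ , cf₁) =
  infer A∈Γ (andI (fromD0 d₀ cf₀) sub₀ (fromD0 d₁ cf₁) sub₁)
fromD0 (orI A₀ A₁ k A∈Γ d sub) cf = infer A∈Γ (orI k (fromD0 d cf) sub)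
fromD0 (allI A A∈Γ Δ ds subs) cf = infer A∈Γ (allI Δ (λ n → fromD0 (ds n) (cf n)) subs)
fromD0 (exI A k A∈Γ d sub) cf = infer A∈Γ (exI k (fromD0 d cf) sub)
fromD0 (all2I A Y A∈Γ Y∉Γ d sub) cf = infer A∈Γ (all2I Y Y∉Γ (fromD0 d cf) sub)
fromD0 (rep d sub) cf = rep (fromD0 d cf) sub

module _ (ρ : Perm) where

  Sub-ren : ∀ {Δ Γ P} → Sub Δ Γ P →
            Sub (List.map (ren ρ) Δ) (List.map (ren ρ) Γ) (λ B → ∃ λ B′ → P B′ × B ≡ ren ρ B′)
  Sub-ren sub B∈ρΔ with ∈-map⁻ (ren ρ) B∈ρΔ
  ... | B′ , B′∈Δ , refl = Sum.map (∈-map⁺ (ren ρ)) (λ PB′ → B′ , PB′ , refl) (sub B′∈Δ)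

  Sub-ren-≡ : ∀ {Δ Γ A A′} → Sub Δ Γ (_≡ A) → ren ρ A ≡ A′ →
              Sub (List.map (ren ρ) Δ) (List.map (ren ρ) Γ) (_≡ A′)
  Sub-ren-≡ sub eq = Sub-map (λ { (_ , refl , refl) → inj₂ eq }) (Sub-ren sub)

  NotFree-ren : ∀ {Γ Y} → NotFree Y Γ → NotFree (to ρ Y) (List.map (ren ρ) Γ)
  NotFree-ren Y∉Γ B∈ρΓ free with ∈-map⁻ (ren ρ) B∈ρΓ
  ... | B′ , B′∈Γ , refl = Y∉Γ B′∈Γ (FreeIn-ren⁻ ρ B′ free)

  renD0 : ∀ {Γ} → D0 Γ → D0 (List.map (ren ρ) Γ)
  renD0 (ax A isTrue A∈Γ) = ax (ren ρ A) (TRUE-renF (to ρ) A isTrue) (∈-map⁺ (ren ρ) A∈Γ)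
  renD0 (axC C C∈Γ ¬C∈Γ) =
    axC (ren ρ C) (∈-map⁺ (ren ρ) C∈Γ) (subst (_∈ _) (renF-neg (to ρ) C) (∈-map⁺ (ren ρ) ¬C∈Γ))
  renD0 (andI A₀ A₁ A∈Γ d₀ sub₀ d₁ sub₁) =
    andI (ren ρ A₀) (ren ρ A₁) (∈-map⁺ (ren ρ) A∈Γ)
         (renD0 d₀) (Sub-ren-≡ sub₀ refl) (renD0 d₁) (Sub-ren-≡ sub₁ refl)
  renD0 (orI A₀ A₁ k A∈Γ d sub) =
    orI (ren ρ A₀) (ren ρ A₁) k (∈-map⁺ (ren ρ) A∈Γ) (renD0 d) (Sub-ren-≡ sub (renF-sel (to ρ) k A₀ A₁))
  renD0 (allI A A∈Γ Δ ds subs) =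
    allI (ren ρ A) (∈-map⁺ (ren ρ) A∈Γ) (List.map (ren ρ) ∘ Δ) (renD0 ∘ ds)
         (λ n → Sub-ren-≡ (subs n) (renF-inst (to ρ) A n))
  renD0 (exI A k A∈Γ d sub) =
    exI (ren ρ A) k (∈-map⁺ (ren ρ) A∈Γ) (renD0 d) (Sub-ren-≡ sub (renF-inst (to ρ) A k))
  renD0 (all2I A Y A∈Γ Y∉Γ d sub) =
    all2I A (to ρ Y) (∈-map⁺ (ren ρ) A∈Γ) (NotFree-ren Y∉Γ)
          (renD0 d) (Sub-ren-≡ sub (renF-instX (to ρ) A Y))
  renD0 (cut C d₀ sub₀ d₁ sub₁) =
    cut (ren ρ C) (renD0 d₀) (Sub-ren-≡ sub₀ refl) (renD0 d₁) (Sub-ren-≡ sub₁ (renF-neg (to ρ) C))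
  renD0 (rep d sub) = rep (renD0 d) (Sub-map (λ { (_ , () , _) }) (Sub-ren sub))

  renD0-CutFree : ∀ {Γ} (e : D0 Γ) → CutFree e → CutFree (renD0 e)
  renD0-CutFree (ax A isTrue A∈Γ) _ = tt
  renD0-CutFree (axC C C∈Γ ¬C∈Γ) _ = tt
  renD0-CutFree (andI A₀ A₁ A∈Γ d₀ sub₀ d₁ sub₁) (cf₀ , cf₁) = renD0-CutFree d₀ cf₀ , renD0-CutFree d₁ cf₁
  renD0-CutFree (orI A₀ A₁ k A∈Γ d sub) cf = renD0-CutFree d cf
  renD0-CutFree (allI A A∈Γ Δ ds subs) cf = λ n → renD0-CutFree (ds n) (cf n)
  renD0-CutFree (exI A k A∈Γ d sub) cf = renD0-CutFree d cf
  renD0-CutFree (all2I A Y A∈Γ Y∉Γ d sub) cf = renD0-CutFree d cf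
  renD0-CutFree (rep d sub) cf = renD0-CutFree d cf

  renIdx : ∀ {A} → Idx A → Idx A
  renIdx {A} q = record
    { Γe = List.map (ren ρ) Γe
    ; e = renD0 e
    ; cf = renD0-CutFree e cf
    ; pi = λ B∈ρΓe → let B′ , B′∈Γe , B≡ = ∈-map⁻ (ren ρ) B∈ρΓe
                     in subst Π1 (sym B≡) (Π1-renF (to ρ) B′ (pi B′∈Γe))
    ; Z = to ρ Z
    ; fresh = fresh′ }
    where
    open Idx q
    fresh′ : ∀ {B} → B ∈ List.map (ren ρ) Γe → B ≢ instX A (to ρ Z) → ¬ FreeIn (to ρ Z) B
    fresh′ B∈ρΓe B≢ρAZ with ∈-map⁻ (ren ρ) B∈ρΓe
    ... | B′ , B′∈Γe , refl =
      fresh B′∈Γe (λ { refl → B≢ρAZ (renF-instX (to ρ) A Z) }) ∘ FreeIn-ren⁻ ρ B′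

-- Replacing the inferences with a given principal formula

Handler : Fm 0 → Seq → Set
Handler C Γ = ∀ {Θ} → Γ ⊆ Θ → Principal Θ C → CF Θ

-- Set variables are renamed lazily by ρ, so that eigenvariables can be moved away
-- from the free variables of the added context Γ while the recursion stays structural.
module Replace (C : Fm 0) (Γ : Seq) (handle : Handler C Γ) where

  Out : Perm → Seq → Seq
  Out ρ Δ = List.map (ren ρ) Δ ∖ C ++ Γ

  ∈-Out : ∀ ρ {Δ B} → B ∈ Δ → ren ρ B ≢ C → ren ρ B ∈ Out ρ Δ
  ∈-Out ρ B∈Δ ρB≢C = ∈-++⁺ˡ (∈-∖⁺ (∈-map⁺ (ren ρ) B∈Δ) ρB≢C)

  Γ⊆Out : ∀ ρ Δ → Γ ⊆ Out ρ Δ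
  Γ⊆Out ρ Δ = ∈-++⁺ʳ (List.map (ren ρ) Δ ∖ C)

  Out⁻ : ∀ ρ Δ {B} → B ∈ Out ρ Δ → B ∈ Γ ⊎ (∃ λ B′ → B′ ∈ Δ × ren ρ B′ ≢ C × B ≡ ren ρ B′)
  Out⁻ ρ Δ B∈Out with ∈-++⁻ (List.map (ren ρ) Δ ∖ C) B∈Out
  ... | inj₂ B∈Γ = inj₁ B∈Γ
  ... | inj₁ B∈ρΔ∖C with ∈-∖⁻ B∈ρΔ∖C
  ...   | B∈ρΔ , B≢C with ∈-map⁻ (ren ρ) B∈ρΔ
  ...     | B′ , B′∈Δ , refl = inj₂ (B′ , B′∈Δ , B≢C , refl)

  Sub-Out : ∀ ρ {Δᵢ Δ P} → Sub Δᵢ Δ P →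
            Sub (Out ρ Δᵢ) (Out ρ Δ) (λ B → ∃ λ B′ → P B′ × B ≡ ren ρ B′)
  Sub-Out ρ {Δᵢ} {Δ} sub B∈Out with Out⁻ ρ Δᵢ B∈Out
  ... | inj₁ B∈Γ = inj₁ (Γ⊆Out ρ Δ B∈Γ)
  ... | inj₂ (B′ , B′∈Δᵢ , ρB′≢C , refl) =
    Sum.map (λ B′∈Δ → ∈-Out ρ B′∈Δ ρB′≢C) (λ PB′ → B′ , PB′ , refl) (sub B′∈Δᵢ)

  Sub-Out-≡ : ∀ ρ {Δᵢ Δ A A′} → Sub Δᵢ Δ (_≡ A) → ren ρ A ≡ A′ → Sub (Out ρ Δᵢ) (Out ρ Δ) (_≡ A′)
  Sub-Out-≡ ρ sub eq = Sub-map (λ { (_ , refl , refl) → inj₂ eq }) (Sub-Out ρ sub)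

  eig : Perm → Seq → SV
  eig ρ Δ = freshFor (C ∷ Out ρ Δ)

  eig-NotFree : ∀ ρ Δ → NotFree (eig ρ Δ) (Out ρ Δ)
  eig-NotFree ρ Δ = freshFor-NotFree (C ∷ Out ρ Δ) ∘ there

  rename : Perm → SV → Seq → Perm
  rename ρ Y Δ = transposition (to ρ Y) (eig ρ Δ) ↔-∘ ρ

  rename-agrees : ∀ ρ Y Δ {B} → B ∈ Δ → NotFree Y Δ → ren (rename ρ Y Δ) B ≡ ren ρ B
  rename-agrees ρ Y Δ {B} B∈Δ Y∉Δ = renF-cong _ _ B λ Z free →
    swap-≢ _ _ _ (Y∉Δ B∈Δ ∘ (λ ρZ≡ρY → subst (λ X → FreeIn X B) (to-injective ρ ρZ≡ρY) free))
                 (eig≢ Z (FreeIn-renF⁺ (to ρ) B free))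
    where
    eig≢ : ∀ Z → FreeIn (to ρ Z) (ren ρ B) → to ρ Z ≢ eig ρ Δ
    eig≢ Z free ρZ≡eig with ren ρ B ≟-Fm C
    ... | yes ρB≡C = freshFor-NotFree (C ∷ Out ρ Δ) (here ρB≡C) eig∈ρB
      where eig∈ρB = subst (λ X → FreeIn X (ren ρ B)) ρZ≡eig free
    ... | no ρB≢C = eig-NotFree ρ Δ (∈-Out ρ B∈Δ ρB≢C) eig∈ρB
      where eig∈ρB = subst (λ X → FreeIn X (ren ρ B)) ρZ≡eig free

  Sub-Out-eig : ∀ ρ {Δᵢ Δ} A Y → NotFree Y Δ → Sub Δᵢ Δ (_≡ instX A Y) →
                Sub (Out (rename ρ Y Δ) Δᵢ) (Out ρ Δ) (_≡ instX A (eig ρ Δ))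
  Sub-Out-eig ρ {Δᵢ} {Δ} A Y Y∉Δ sub B∈Out with Out⁻ (rename ρ Y Δ) Δᵢ B∈Out
  ... | inj₁ B∈Γ = inj₁ (Γ⊆Out ρ Δ B∈Γ)
  ... | inj₂ (B′ , B′∈Δᵢ , ρ′B′≢C , refl) with sub B′∈Δᵢ
  ...   | inj₁ B′∈Δ = inj₁ (subst (_∈ Out ρ Δ) (sym agrees) (∈-Out ρ B′∈Δ (ρ′B′≢C ∘ trans agrees)))
    where agrees = rename-agrees ρ Y Δ B′∈Δ Y∉Δ
  ...   | inj₂ refl = inj₂ (trans (renF-instX _ A Y) (cong (instX A) (swap-≡ˡ (to ρ Y) (eig ρ Δ))))

  -- The premise with index q of a renamed Ω-inference is the original premise with index ρ⁻¹ q.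
  Sub-Out-Ω : ∀ ρ {A Δ} (Δs : Idx A → Seq) → (∀ q → Sub (Δs q) Δ (Minor q)) →
              ∀ q → Sub (Out ρ (Δs (renIdx (↔-sym ρ) q))) (Out ρ Δ) (Minor q)
  Sub-Out-Ω ρ {A} Δs subs q B∈Out with Sub-Out ρ (subs (renIdx (↔-sym ρ) q)) B∈Out
  ... | inj₁ B∈OutΔ = inj₁ B∈OutΔ
  ... | inj₂ (B′ , (B′∈ , B′≢) , refl) with ∈-map⁻ (ren (↔-sym ρ)) B′∈
  ...   | B , B∈Γe , refl =
    inj₂ (subst (_∈ Idx.Γe q) (sym (ren-from ρ B)) B∈Γe ,
          λ eq → B′≢ (trans (cong (ren (↔-sym ρ)) (trans (sym (ren-from ρ B)) eq))
                            (renF-instX (from ρ) A _)))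

  conclude : ∀ ρ {Δ A} → A ∈ Δ → Principal (Out ρ Δ) (ren ρ A) → CF (Out ρ Δ)
  conclude ρ {Δ} {A} A∈Δ r with ren ρ A ≟-Fm C
  ... | yes ρA≡C = handle (Γ⊆Out ρ Δ) (subst (Principal _) ρA≡C r)
  ... | no ρA≢C = infer (∈-Out ρ A∈Δ ρA≢C) r

  mutual
    replace : ∀ ρ {Δ} → CF Δ → CF (Out ρ Δ)
    replace ρ (infer A∈Δ r) = replaceInference ρ A∈Δ r
    replace ρ {Δ} (Ω~ A Y Y∉Δ d sub Δs ds subs) =
      Ω~ A (eig ρ Δ) (eig-NotFree ρ Δ) (replace (rename ρ Y Δ) d) (Sub-Out-eig ρ A Y Y∉Δ sub)
         (λ q → Out ρ (Δs (renIdx (↔-sym ρ) q))) (λ q → replace ρ (ds (renIdx (↔-sym ρ) q)))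
         (Sub-Out-Ω ρ Δs subs)
    replace ρ (rep d sub) = rep (replace ρ d) (Sub-map (λ { (_ , () , _) }) (Sub-Out ρ sub))

    replaceInference : ∀ ρ {Δ A} → A ∈ Δ → Principal Δ A → CF (Out ρ Δ)
    replaceInference ρ {A = A} A∈Δ (ax isTrue) = conclude ρ A∈Δ (ax (TRUE-renF (to ρ) A isTrue))
    replaceInference ρ {Δ} {A} A∈Δ (axC ¬A∈Δ) with ren ρ (neg A) ≟-Fm C
    ... | yes ρ¬A≡C = handle (Γ⊆Out ρ Δ) (axC (subst (_∈ Out ρ Δ) ρA≡¬C (∈-Out ρ A∈Δ ρA≢C)))
      where
      ρA≡¬C : ren ρ A ≡ neg C
      ρA≡¬C = trans (sym (neg-involutive _)) (cong neg (trans (sym (renF-neg (to ρ) A)) ρ¬A≡C))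
      ρA≢C : ren ρ A ≢ C
      ρA≢C ρA≡C = neg-≢ C (trans (sym ρA≡¬C) ρA≡C)
    ... | no ρ¬A≢C =
      conclude ρ A∈Δ (axC (subst (_∈ Out ρ Δ) (renF-neg (to ρ) A) (∈-Out ρ ¬A∈Δ ρ¬A≢C)))
    replaceInference ρ A∈Δ (andI d₀ sub₀ d₁ sub₁) =
      conclude ρ A∈Δ (andI (replace ρ d₀) (Sub-Out-≡ ρ sub₀ refl)
                           (replace ρ d₁) (Sub-Out-≡ ρ sub₁ refl))
    replaceInference ρ A∈Δ (orI {A₀} {A₁} k d sub) =
      conclude ρ A∈Δ (orI k (replace ρ d) (Sub-Out-≡ ρ sub (renF-sel (to ρ) k A₀ A₁)))
    replaceInference ρ A∈Δ (allI {A} Δs ds subs) =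
      conclude ρ A∈Δ (allI (Out ρ ∘ Δs) (replace ρ ∘ ds)
                           (λ n → Sub-Out-≡ ρ (subs n) (renF-inst (to ρ) A n)))
    replaceInference ρ A∈Δ (exI {A} k d sub) =
      conclude ρ A∈Δ (exI k (replace ρ d) (Sub-Out-≡ ρ sub (renF-inst (to ρ) A k)))
    replaceInference ρ {Δ} A∈Δ (all2I {A} Y Y∉Δ d sub) =
      conclude ρ A∈Δ (all2I (eig ρ Δ) (eig-NotFree ρ Δ)
                            (replace (rename ρ Y Δ) d) (Sub-Out-eig ρ A Y Y∉Δ sub))
    replaceInference ρ A∈Δ (Ω refl Δs ds subs) =
      conclude ρ A∈Δ (Ω refl (λ q → Out ρ (Δs (renIdx (↔-sym ρ) q)))
                             (λ q → replace ρ (ds (renIdx (↔-sym ρ) q))) (Sub-Out-Ω ρ Δs subs))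

eliminate : ∀ {C Γ Δ} → Handler C Γ → CF Δ → Sub Δ Γ (_≡ C) → CF Γ
eliminate {C} {Γ} {Δ} handle d sub = rep (replace (↔-id SV) d) Out⊆Γ
  where
  open Replace C Γ handle
  Out⊆Γ : Sub (Out (↔-id SV) Δ) Γ NoMinor
  Out⊆Γ B∈Out with Out⁻ (↔-id SV) Δ B∈Out
  ... | inj₁ B∈Γ = inj₁ B∈Γ
  ... | inj₂ (B , B∈Δ , B≢C , refl) =
    inj₁ (subst (_∈ Γ) (sym (renF-id B))
                ([ id , (λ B≡C → ⊥-elim (B≢C (trans (renF-id B) B≡C))) ]′ (sub B∈Δ)))

inv-∧ : ∀ A₀ A₁ k {Δ Γ} → CF Δ → Sub Δ Γ (_≡ A₀ ∧ A₁) → CF (sel k A₀ A₁ ∷ Γ)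
inv-∧ A₀ A₁ k {Γ = Γ} d sub = eliminate handle d (Sub-weaken there sub)
  where
  handle : Handler (A₀ ∧ A₁) (sel k A₀ A₁ ∷ Γ)
  handle Γ⊆Θ (ax ())
  handle Γ⊆Θ (axC ¬C∈Θ) =
    infer ¬C∈Θ (orI k (infer (there (Γ⊆Θ (here refl))) (axC (here refl)))
                      (Sub-map (λ { refl → inj₂ (neg-sel k A₀ A₁) }) Sub-∷))
  handle {Θ} Γ⊆Θ (andI d₀ sub₀ d₁ sub₁) = premise k (Γ⊆Θ (here refl))
    where
    premise : ∀ k → sel k A₀ A₁ ∈ Θ → CF Θ
    premise false A₀∈Θ = weaken d₀ (Sub⇒⊆ A₀∈Θ sub₀)
    premise true A₁∈Θ = weaken d₁ (Sub⇒⊆ A₁∈Θ sub₁)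

inv-∨ : ∀ A₀ A₁ {Δ Γ} → CF Δ → Sub Δ Γ (_≡ A₀ ∨ A₁) → CF (A₀ ∷ A₁ ∷ Γ)
inv-∨ A₀ A₁ {Γ = Γ} d sub = eliminate handle d (Sub-weaken (there ∘ there) sub)
  where
  handle : Handler (A₀ ∨ A₁) (A₀ ∷ A₁ ∷ Γ)
  handle Γ⊆Θ (ax ())
  handle Γ⊆Θ (axC ¬C∈Θ) =
    infer ¬C∈Θ (andI (infer (there (Γ⊆Θ (here refl))) (axC (here refl))) Sub-∷
                     (infer (there (Γ⊆Θ (there (here refl)))) (axC (here refl))) Sub-∷)
  handle Γ⊆Θ (orI false d sub) = weaken d (Sub⇒⊆ (Γ⊆Θ (here refl)) sub)
  handle Γ⊆Θ (orI true d sub) = weaken d (Sub⇒⊆ (Γ⊆Θ (there (here refl))) sub)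

inv-∀ : ∀ A k {Δ Γ} → CF Δ → Sub Δ Γ (_≡ all A) → CF (inst A k ∷ Γ)
inv-∀ A k {Γ = Γ} d sub = eliminate handle d (Sub-weaken there sub)
  where
  handle : Handler (all A) (inst A k ∷ Γ)
  handle Γ⊆Θ (ax ())
  handle Γ⊆Θ (axC ¬C∈Θ) =
    infer ¬C∈Θ (exI k (infer (there (Γ⊆Θ (here refl))) (axC (here refl)))
                      (Sub-map (λ { refl → inj₂ (neg-inst A k) }) Sub-∷))
  handle Γ⊆Θ (allI Δs ds subs) = weaken (ds k) (Sub⇒⊆ (Γ⊆Θ (here refl)) (subs k))

minors : ∀ {A} → Idx A → Seq
minors {A} q = Idx.Γe q ∖ instX A (Idx.Z q)

Sub-minors : ∀ {A} (q : Idx A) Γ → Sub (minors q ++ Γ) Γ (Minor q)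
Sub-minors q Γ B∈ with ∈-++⁻ (minors q) B∈
... | inj₁ B∈minors = inj₂ (∈-∖⁻ B∈minors)
... | inj₂ B∈Γ = inj₁ B∈Γ

-- Each Ω-inference for ¬∀X A is replaced by its premise q; an axiom ∀X A, ¬∀X A by
-- the ∀X-inference that closes e.
inv-Ω : ∀ A (q : Idx A) {Δ Γ} → CF Δ → Sub Δ Γ (_≡ neg (all2 A)) → CF (minors q ++ Γ)
inv-Ω A q {Γ = Γ} d sub = eliminate handle d (Sub-weaken (∈-++⁺ʳ (minors q)) sub)
  where
  open Idx q
  handle : Handler (neg (all2 A)) (minors q ++ Γ)
  handle Γ⊆Θ (ax ())
  handle {Θ} Γ⊆Θ (axC ¬C∈Θ) = weaken (infer (here refl) (all2I Z Z∉ (fromD0 e cf) subZ)) ⊆Θ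
    where
    Z∉ : NotFree Z (all2 A ∷ minors q)
    Z∉ (here refl) ()
    Z∉ (there B∈) = uncurry fresh (∈-∖⁻ B∈)
    subZ : Sub Γe (all2 A ∷ minors q) (_≡ instX A Z)
    subZ {B} B∈Γe with B ≟-Fm instX A Z
    ... | yes B≡AZ = inj₂ B≡AZ
    ... | no B≢AZ = inj₁ (there (∈-∖⁺ B∈Γe B≢AZ))
    ⊆Θ : (all2 A ∷ minors q) ⊆ Θ
    ⊆Θ (here refl) = subst (λ B → all2 B ∈ Θ) (negB-involutive A) ¬C∈Θ
    ⊆Θ (there B∈) = Γ⊆Θ (∈-++⁺ˡ B∈)
  handle Γ⊆Θ (Ω eq Δs ds subs) with negB-injective eq
  ... | refl = weaken (ds q) λ B∈ →
    [ id , (λ (B∈Γe , B≢AZ) → Γ⊆Θ (∈-++⁺ˡ (∈-∖⁺ B∈Γe B≢AZ))) ]′ (subs q B∈)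

data Literal : Fm 0 → Set where
  rel  : ∀ {k} (f : PR k) ts → Literal (rel f ts)
  nrel : ∀ {k} (f : PR k) ts → Literal (nrel f ts)
  mem  : ∀ Y t → Literal (mem Y t)
  nmem : ∀ Y t → Literal (nmem Y t)

Literal-neg : ∀ {C} → Literal C → Literal (neg C)
Literal-neg (rel f ts) = nrel f ts
Literal-neg (nrel f ts) = rel f ts
Literal-neg (mem Y t) = nmem Y t
Literal-neg (nmem Y t) = mem Y t

Literal-principal : ∀ {C Θ} → Literal C → Principal Θ C → TRUE C ⊎ neg C ∈ Θ
Literal-principal _ (ax isTrue) = inj₁ isTrue
Literal-principal _ (axC ¬C∈Θ) = inj₂ ¬C∈Θ
Literal-principal () (andI _ _ _ _)
Literal-principal () (orI _ _ _)
Literal-principal () (allI _ _ _)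
Literal-principal () (exI _ _ _)
Literal-principal () (all2I _ _ _ _)
Literal-principal () (Ω _ _ _ _)

CutFor : Fm 0 → Set
CutFor C = ∀ {Γ Δ₀ Δ₁} → CF Δ₀ → Sub Δ₀ Γ (_≡ C) → CF Δ₁ → Sub Δ₁ Γ (_≡ neg C) → CF Γ

cut-literal : ∀ {C} → Literal C → CutFor C
cut-literal {C} lit {Γ} d₀ sub₀ d₁ sub₁ = eliminate handle₀ d₀ sub₀
  where
  handle₀ : Handler C Γ
  handle₀ {Θ} Γ⊆Θ r with Literal-principal lit r
  ... | inj₂ ¬C∈Θ = weaken d₁ (Sub⇒⊆ ¬C∈Θ (Sub-weaken Γ⊆Θ sub₁))
  ... | inj₁ C-true = eliminate handle₁ d₁ (Sub-weaken Γ⊆Θ sub₁)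
    where
    handle₁ : Handler (neg C) Θ
    handle₁ _ r′ with Literal-principal (Literal-neg lit) r′
    ... | inj₁ ¬C-true = ⊥-elim (TRUE-neg C C-true ¬C-true)
    ... | inj₂ ¬¬C∈Θ′ = infer (subst (_∈ _) (neg-involutive C) ¬¬C∈Θ′) (ax C-true)

-- By the symmetry of cut only one formula of each pair C, neg C needs to be treated.
data Positive : Fm 0 → Set where
  rel  : ∀ {k} (f : PR k) ts → Positive (rel f ts)
  mem  : ∀ Y t → Positive (mem Y t)
  _∧_  : ∀ A₀ A₁ → Positive (A₀ ∧ A₁)
  all  : ∀ A → Positive (all A)
  all2 : ∀ A → Positive (all2 A)

polarity : ∀ C → Positive C ⊎ Positive (neg C)
polarity (rel f ts) = inj₁ (rel f ts)
polarity (nrel f ts) = inj₂ (rel f ts)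
polarity (mem Y t) = inj₁ (mem Y t)
polarity (nmem Y t) = inj₂ (mem Y t)
polarity (A₀ ∧ A₁) = inj₁ (A₀ ∧ A₁)
polarity (A₀ ∨ A₁) = inj₂ (neg A₀ ∧ neg A₁)
polarity (all A) = inj₁ (all A)
polarity (ex A) = inj₂ (all (neg A))
polarity (all2 A) = inj₁ (all2 A)
polarity (ex2 A) = inj₂ (all2 (negB A))

mutual
  cut-admissible : ∀ n C → rk C ≤ n → CutFor C
  cut-admissible n C rk≤n with polarity C
  ... | inj₁ pos = cut-positive n pos rk≤n
  ... | inj₂ pos¬ = λ d₀ sub₀ d₁ sub₁ →
    cut-positive n pos¬ (subst (_≤ n) (sym (rk-neg C)) rk≤n)
      d₁ sub₁ d₀ (Sub-map (λ { refl → inj₂ (sym (neg-involutive C)) }) sub₀)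

  cut-positive : ∀ n {C} → Positive C → rk C ≤ n → CutFor C
  cut-positive n (rel f ts) _ = cut-literal (rel f ts)
  cut-positive n (mem Y t) _ = cut-literal (mem Y t)
  cut-positive (suc n) (A₀ ∧ A₁) (s≤s rk≤n) {Γ} d₀ sub₀ d₁ sub₁ =
    cut-admissible n A₁ (≤-trans (m≤n⊔m _ _) rk≤n) (inv-∧ A₀ A₁ true d₀ sub₀) Sub-∷ cut₀ Sub-∷
    where
    cut₀ : CF (neg A₁ ∷ Γ)
    cut₀ = cut-admissible n A₀ (≤-trans (m≤m⊔n _ _) rk≤n)
             (inv-∧ A₀ A₁ false d₀ sub₀) (Sub-weaken there Sub-∷)
             (inv-∨ (neg A₀) (neg A₁) d₁ sub₁) Sub-∷
  cut-positive (suc n) (all A) (s≤s rk≤n) {Γ} d₀ sub₀ d₁ sub₁ = eliminate handle d₁ sub₁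
    where
    handle : Handler (ex (neg A)) Γ
    handle Γ⊆Θ (ax ())
    handle {Θ} Γ⊆Θ (axC ¬C∈Θ) =
      weaken d₀ (Sub⇒⊆ (subst (_∈ Θ) (neg-involutive (all A)) ¬C∈Θ) (Sub-weaken Γ⊆Θ sub₀))
    handle Γ⊆Θ (exI k d sub) =
      cut-admissible n (inst A k) (subst (_≤ n) (sym (rk-subF (inst0 k) A)) rk≤n)
        (inv-∀ A k d₀ (Sub-weaken Γ⊆Θ sub₀)) Sub-∷
        d (Sub-map (λ { refl → inj₂ (sym (neg-inst A k)) }) sub)
  cut-positive n (all2 A) _ {Γ} d₀ sub₀ d₁ sub₁ = eliminate handle d₀ sub₀
    where
    handle : Handler (all2 A) Γ
    handle Γ⊆Θ (ax ())
    handle Γ⊆Θ (axC ¬C∈Θ) = weaken d₁ (Sub⇒⊆ ¬C∈Θ (Sub-weaken Γ⊆Θ sub₁))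
    handle {Θ} Γ⊆Θ (all2I Y Y∉Θ d sub) =
      Ω~ A Y Y∉Θ d sub (λ q → minors q ++ Θ) (λ q → inv-Ω A q d₁ (Sub-weaken Γ⊆Θ sub₁))
         (λ q → Sub-minors q Θ)

eliminate-cuts : ∀ {Γ} → D Γ → CF Γ
eliminate-cuts (ax A isTrue A∈Γ) = infer A∈Γ (ax isTrue)
eliminate-cuts (axC C C∈Γ ¬C∈Γ) = infer C∈Γ (axC ¬C∈Γ)
eliminate-cuts (andI A₀ A₁ A∈Γ d₀ sub₀ d₁ sub₁) =
  infer A∈Γ (andI (eliminate-cuts d₀) sub₀ (eliminate-cuts d₁) sub₁)
eliminate-cuts (orI A₀ A₁ k A∈Γ d sub) = infer A∈Γ (orI k (eliminate-cuts d) sub)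
eliminate-cuts (allI A A∈Γ Δ ds subs) = infer A∈Γ (allI Δ (eliminate-cuts ∘ ds) subs)
eliminate-cuts (exI A k A∈Γ d sub) = infer A∈Γ (exI k (eliminate-cuts d) sub)
eliminate-cuts (all2I A Y A∈Γ Y∉Γ d sub) = infer A∈Γ (all2I Y Y∉Γ (eliminate-cuts d) sub)
eliminate-cuts (cut C d₀ sub₀ d₁ sub₁) =
  cut-admissible (rk C) C ≤-refl (eliminate-cuts d₀) sub₀ (eliminate-cuts d₁) sub₁
eliminate-cuts (rep d sub) = rep (eliminate-cuts d) sub
eliminate-cuts (Ω A ¬C∈Γ Δ ds subs) = infer ¬C∈Γ (Ω refl Δ (eliminate-cuts ∘ ds) subs)
eliminate-cuts (Ω~ A Y Y∉Γ d sub Δ ds subs) =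
  Ω~ A Y Y∉Γ (eliminate-cuts d) sub Δ (eliminate-cuts ∘ ds) subs

theorem3 : Σ (Deriv → Deriv) (λ E → (d : Deriv) → ((Γ : Seq) → d ⊢[ ω ] Γ → E d ⊢[ fin 0 ] Γ) × (Γof (E d) ≋ Γof d))
theorem3 = Eω , λ (Γ , d) → (λ _ (Γ≋ , _) → Γ≋ , embed-cutFree (eliminate-cuts d)) , (id , id)
  where
  Eω : Deriv → Deriv
  Eω (Γ , d) = Γ , embed (eliminate-cuts d)
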